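{- For every $0<\kappa<\beta\leq 1$ there exists $n_0$ such that for every $n\geq n_0$ the following holds. Let $H$ be an $n$-vertex $3$-graph with $\delta_2^*(H_\beta)\geq \beta n$. If $\{x,y\}$ is $\beta$-relevant in $H$, then $\{x,y\}$ is $(\beta-\kappa)$-relevant in $H-U$ for any $U\subseteq V(H)$ satisfying $|U|\leq \kappa n$ and $\{x,y\}\cap U=\emptyset$.
   Context: A $3$-graph is a $3$-uniform hypergraph; $H-U$ denotes the subgraph induced on $V(H)\setminus U$. The codegree $\deg_H(u,v)$ is the number of vertices $w$ with $\{u,v,w\}\in E(H)$. For $\beta>0$, $H_\beta$ is obtained from $H$ by removing every edge containing a pair $\{u,v\}$ with $\deg_H(u,v)<\beta|V(H)|$; a pair is $\beta$-relevant in $H$ if it is contained in an edge of $H_\beta$. For a $3$-graph $F$, $\delta_2^*(F)=\min\{\deg_F(u,v): \{u,v\}\text{ is contained in some edge of }F\}$.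
   Formalization: The parameters κ and β range over the rationals. -}

module Defs where

open import Data.Nat using (ℕ; zero; suc; _+_)
open import Data.Bool using (Bool; true; false; _∧_; if_then_else_)
open import Data.Fin using (Fin; zero; suc)
open import Data.Fin.Subset using (Subset)
open import Data.Vec using (lookup)
open import Data.Integer using (+_)
open import Data.Rational using (ℚ; _/_; _*_; _≤_)
open import Data.Rational.Properties using (_≤?_)
open import Data.Product using (∃)
open import Relation.Nullary.Decidable using (⌊_⌋)
open import Relation.Binary.PropositionalEquality using (_≡_)

toℚ : ℕ → ℚ
toℚ k = + k / 1

-- A (candidate) edge relation of a 3-graph on vertex universe Fin n:
-- E u v w = true iff {u,v,w} is an edge.
Edges : ℕ → Set
Edges n = Fin n → Fin n → Fin n → Bool

-- E is a 3-uniform hypergraph: symmetric in its arguments, and edges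
-- consist of three distinct vertices (the remaining coincidence cases
-- follow from symmetry).
Is3Graph : ∀ {n} → Edges n → Set
Is3Graph E = (∀ u v w → E u v w ≡ E v u w)
           × (∀ u v w → E u v w ≡ E u w v)
           × (∀ u w → E u u w ≡ false)
  where open import Data.Product using (_×_)

countF : ∀ {n} → (Fin n → Bool) → ℕ
countF {zero} p = 0
countF {suc n} p = (if p zero then 1 else 0) + countF (λ i → p (suc i))

codeg : ∀ {n} → Edges n → Fin n → Fin n → ℕ
codeg E u v = countF (λ w → E u v w)

-- Induced subhypergraph on the vertex set S (edges with all three
-- vertices in S).  H - U is  induced (∁ U) E, with |V(H-U)| = ∣ ∁ U ∣.
induced : ∀ {n} → Subset n → Edges n → Edges n
induced S E u v w = E u v w ∧ lookup S u ∧ lookup S v ∧ lookup S w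

-- H_β for a 3-graph with N vertices: keep an edge iff each of its three
-- pairs has codegree ≥ β N (i.e. remove edges containing a pair with
-- codegree < β N).
thin : ∀ {n} → ℚ → ℕ → Edges n → Edges n
thin β N E u v w =
  E u v w ∧ big u v ∧ big u w ∧ big v w
  where
  big : _ → _ → Bool
  big a b = ⌊ β * toℚ N ≤? toℚ (codeg E a b) ⌋

InEdge : ∀ {n} → Edges n → Fin n → Fin n → Set
InEdge F x y = ∃ λ w → F x y w ≡ true

Relevant : ∀ {n} → ℚ → ℕ → Edges n → Fin n → Fin n → Set
Relevant β N E x y = InEdge (thin β N E) x y

MinPosCodegAtLeast : ∀ {n} → Edges n → ℚ → Set
MinPosCodegAtLeast F d = ∀ u v → InEdge F u v → d ≤ toℚ (codeg F u v)

-- A β-relevant pair {x,y} lies in at least βn edges of H_β, by the minimum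
-- positive codegree of H_β.  Since |U| ≤ κn < βn, one of them, {x,y,w}, avoids U.
-- Each pair of {x,y,w} has codegree at least βn in H, so at least βn − κn in H − U,
-- and βn − κn ≥ (β − κ)|V(H − U)|; hence {x,y,w} is an edge of (H − U)_{β−κ}.
module Submission where

open import Defs
open import Data.Nat as ℕ using (ℕ; zero; suc; _≥_; z≤n; s≤s)
import Data.Nat.Properties as ℕP
open import Data.Integer as ℤ using (+_)
import Data.Integer.Properties as ℤP
open import Data.Rational
  using (ℚ; 0ℚ; 1ℚ; _*_; _-_; _+_; -_; _<_; _≤_; toℚᵘ; Positive; NonNegative; nonNegative)
open import Data.Rational.Properties as QP using (_≤?_)
open import Data.Rational.Unnormalised as ℚᵘ using (mkℚᵘ; _≃_)
import Data.Rational.Unnormalised.Properties as ℚᵘP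
open import Data.Rational.Solver using (module +-*-Solver)
open import Data.Bool using (Bool; true; false; _∧_)
open import Data.Bool.Properties using (T-≡)
open import Data.Fin using (Fin; zero; suc)
open import Data.Fin.Properties using (nonZeroIndex)
open import Data.Fin.Subset using (Subset; ∁; ∣_∣; _∉_)
open import Data.Fin.Subset.Properties using (x∉p⇒x∈∁p; x∈∁p⇒x∉p; ∣∁p∣≡n∸∣p∣)
open import Data.Vec using ([]; _∷_; lookup)
open import Data.Vec.Properties using ([]=⇒lookup; lookup⇒[]=)
open import Data.Product using (∃; _,_; _×_)
open import Function using (_∘_; Equivalence)
open import Relation.Nullary using (Dec)
open import Relation.Nullary.Decidable using (⌊_⌋; toWitness; fromWitness)
open import Relation.Binary.PropositionalEquality

∧-true : ∀ {a b} → a ≡ true → b ≡ true → a ∧ b ≡ true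
∧-true refl b≡true = b≡true

∧-true⁻¹ : ∀ a {b} → a ∧ b ≡ true → a ≡ true × b ≡ true
∧-true⁻¹ true b≡true = refl , b≡true

toℚᵘ-toℚ : ∀ k → toℚᵘ (toℚ k) ≃ mkℚᵘ (+ k) 0
toℚᵘ-toℚ k = QP.toℚᵘ-fromℚᵘ (mkℚᵘ (+ k) 0)

toℚ-mono-≤ : ∀ {a b} → a ℕ.≤ b → toℚ a ≤ toℚ b
toℚ-mono-≤ {a} {b} a≤b = QP.toℚᵘ-cancel-≤ (begin
  toℚᵘ (toℚ a) ≃⟨ toℚᵘ-toℚ a ⟩
  mkℚᵘ (+ a) 0 ≤⟨ ℚᵘ.*≤* (ℤP.*-monoʳ-≤-nonNeg (+ 1) (ℤ.+≤+ a≤b)) ⟩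
  mkℚᵘ (+ b) 0 ≃⟨ ℚᵘP.≃-sym (toℚᵘ-toℚ b) ⟩
  toℚᵘ (toℚ b) ∎)
  where open ℚᵘP.≤-Reasoning

toℚ-+ : ∀ a b → toℚ (a ℕ.+ b) ≡ toℚ a + toℚ b
toℚ-+ a b = QP.toℚᵘ-injective (begin-equality
  toℚᵘ (toℚ (a ℕ.+ b))               ≃⟨ toℚᵘ-toℚ (a ℕ.+ b) ⟩
  mkℚᵘ (+ (a ℕ.+ b)) 0               ≃⟨ ℚᵘ.*≡* (cong (ℤ._* + 1) +a+b≡+a*1+b*1) ⟩
  mkℚᵘ (+ a) 0 ℚᵘ.+ mkℚᵘ (+ b) 0     ≃⟨ ℚᵘP.≃-sym (ℚᵘP.+-cong (toℚᵘ-toℚ a) (toℚᵘ-toℚ b)) ⟩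
  toℚᵘ (toℚ a) ℚᵘ.+ toℚᵘ (toℚ b)     ≃⟨ ℚᵘP.≃-sym (QP.toℚᵘ-homo-+ (toℚ a) (toℚ b)) ⟩
  toℚᵘ (toℚ a + toℚ b)               ∎)
  where
  open ℚᵘP.≤-Reasoning
  +a+b≡+a*1+b*1 : + (a ℕ.+ b) ≡ + a ℤ.* + 1 ℤ.+ + b ℤ.* + 1
  +a+b≡+a*1+b*1 = trans (ℤP.pos-+ a b) (sym (cong₂ ℤ._+_ (ℤP.*-identityʳ (+ a)) (ℤP.*-identityʳ (+ b))))

toℚ-pos : ∀ n .{{_ : ℕ.NonZero n}} → Positive (toℚ n)
toℚ-pos n = QP.normalize-pos n 1

toℚ-cancel-< : ∀ {a b} → toℚ a < toℚ b → a ℕ.< b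
toℚ-cancel-< h = ℕP.≰⇒> (λ b≤a → QP.<-irrefl refl (QP.<-≤-trans h (toℚ-mono-≤ b≤a)))

countF-cong : ∀ {n} {p q : Fin n → Bool} → (∀ z → p z ≡ q z) → countF p ≡ countF q
countF-cong {zero}  p≗q = refl
countF-cong {suc n} p≗q rewrite p≗q zero = cong (_ ℕ.+_) (countF-cong (p≗q ∘ suc))

countF⇒∃ : ∀ {n} (p : Fin n → Bool) → 0 ℕ.< countF p → ∃ λ z → p z ≡ true
countF⇒∃ {suc n} p pos with p zero in eq
... | true  = zero , eq
... | false = let z , pz = countF⇒∃ (p ∘ suc) pos in suc z , pz

countF≤countF-∁+∣∣ : ∀ {n} (U : Subset n) (p : Fin n → Bool) →
                     countF p ℕ.≤ countF (λ z → p z ∧ lookup (∁ U) z) ℕ.+ ∣ U ∣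
countF≤countF-∁+∣∣ []          p = z≤n
countF≤countF-∁+∣∣ (true ∷ U)  p with p zero
... | true  = subst (countF (p ∘ suc) ℕ.<_) (sym (ℕP.+-suc _ ∣ U ∣)) (s≤s (countF≤countF-∁+∣∣ U (p ∘ suc)))
... | false = ℕP.≤-trans (countF≤countF-∁+∣∣ U (p ∘ suc)) (ℕP.+-monoʳ-≤ _ (ℕP.n≤1+n ∣ U ∣))
countF≤countF-∁+∣∣ (false ∷ U) p with p zero
... | true  = s≤s (countF≤countF-∁+∣∣ U (p ∘ suc))
... | false = countF≤countF-∁+∣∣ U (p ∘ suc)

∃-outside : ∀ {n} (U : Subset n) (p : Fin n → Bool) →
            ∣ U ∣ ℕ.< countF p → ∃ λ z → z ∉ U × p z ≡ true
∃-outside {n} U p ∣U∣<#p =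
  let z , pz∧z∈∁U = countF⇒∃ p∁ #p∁>0
      pz , z∈∁U  = ∧-true⁻¹ (p z) pz∧z∈∁U
  in z , x∈∁p⇒x∉p (lookup⇒[]= z (∁ U) z∈∁U) , pz
  where
  p∁ : Fin n → Bool
  p∁ z = p z ∧ lookup (∁ U) z
  #p∁>0 : 0 ℕ.< countF p∁
  #p∁>0 = ℕP.+-cancelʳ-< ∣ U ∣ 0 (countF p∁) (ℕP.<-≤-trans ∣U∣<#p (countF≤countF-∁+∣∣ U p))

∉⇒lookup-∁ : ∀ {n} {U : Subset n} {x} → x ∉ U → lookup (∁ U) x ≡ true
∉⇒lookup-∁ x∉U = []=⇒lookup (x∉p⇒x∈∁p x∉U)

∣∁∣≤n : ∀ {n} (U : Subset n) → ∣ ∁ U ∣ ℕ.≤ n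
∣∁∣≤n {n} U = subst (ℕ._≤ n) (sym (∣∁p∣≡n∸∣p∣ U)) (ℕP.m∸n≤m n ∣ U ∣)

⌊⌋≡true⇒ : ∀ {P : Set} (P? : Dec P) → ⌊ P? ⌋ ≡ true → P
⌊⌋≡true⇒ P? eq = toWitness {a? = P?} (Equivalence.from T-≡ eq)

⌊⌋≡true⇐ : ∀ {P : Set} (P? : Dec P) → P → ⌊ P? ⌋ ≡ true
⌊⌋≡true⇐ P? p = Equivalence.to T-≡ (fromWitness {a? = P?} p)

HighCodeg : ∀ {n} → ℚ → ℕ → Edges n → Fin n → Fin n → Set
HighCodeg β N E a b = β * toℚ N ≤ toℚ (codeg E a b)

thin-sound : ∀ {n} β N (E : Edges n) a b c → thin β N E a b c ≡ true →
             E a b c ≡ true × HighCodeg β N E a b × HighCodeg β N E a c × HighCodeg β N E b c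
thin-sound {n} β N E a b c h =
  let e  , h₁ = ∧-true⁻¹ (E a b c) h
      ab , h₂ = ∧-true⁻¹ (high? a b) h₁
      ac , bc = ∧-true⁻¹ (high? a c) h₂
  in e , high a b ab , high a c ac , high b c bc
  where
  high? : Fin n → Fin n → Bool
  high? u v = ⌊ β * toℚ N ≤? toℚ (codeg E u v) ⌋
  high : ∀ u v → high? u v ≡ true → HighCodeg β N E u v
  high u v = ⌊⌋≡true⇒ (β * toℚ N ≤? toℚ (codeg E u v))

thin-complete : ∀ {n} β N (E : Edges n) a b c → E a b c ≡ true →
                HighCodeg β N E a b → HighCodeg β N E a c → HighCodeg β N E b c →
                thin β N E a b c ≡ true
thin-complete β N E a b c e hab hac hbc =
  ∧-true e (∧-true (high a b hab) (∧-true (high a c hac) (high b c hbc)))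
  where
  high : ∀ u v → HighCodeg β N E u v → ⌊ β * toℚ N ≤? toℚ (codeg E u v) ⌋ ≡ true
  high u v = ⌊⌋≡true⇐ (β * toℚ N ≤? toℚ (codeg E u v))

induced-∁-edge : ∀ {n} (U : Subset n) (E : Edges n) {a b c} → a ∉ U → b ∉ U → c ∉ U →
                 E a b c ≡ true → induced (∁ U) E a b c ≡ true
induced-∁-edge U E a∉U b∉U c∉U e
  rewrite e | ∉⇒lookup-∁ a∉U | ∉⇒lookup-∁ b∉U | ∉⇒lookup-∁ c∉U = refl

codeg≤codeg-induced-∁+∣∣ : ∀ {n} (U : Subset n) (E : Edges n) {a b} → a ∉ U → b ∉ U →
                           codeg E a b ℕ.≤ codeg (induced (∁ U) E) a b ℕ.+ ∣ U ∣
codeg≤codeg-induced-∁+∣∣ U E {a} {b} a∉U b∉U =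
  subst (λ k → codeg E a b ℕ.≤ k ℕ.+ ∣ U ∣) (countF-cong restrict) (countF≤countF-∁+∣∣ U (E a b))
  where
  restrict : ∀ w → (E a b w ∧ lookup (∁ U) w) ≡ induced (∁ U) E a b w
  restrict w rewrite ∉⇒lookup-∁ a∉U | ∉⇒lookup-∁ b∉U = refl

threshold-drop : ∀ {β κ} {n m c c′ u : ℕ} → κ ≤ β → m ℕ.≤ n →
                 β * toℚ n ≤ toℚ c → toℚ u ≤ κ * toℚ n → c ℕ.≤ c′ ℕ.+ u →
                 (β - κ) * toℚ m ≤ toℚ c′
threshold-drop {β} {κ} {n} {m} {c} {c′} {u} κ≤β m≤n βn≤c u≤κn c≤c′+u = begin
  (β - κ) * toℚ m       ≤⟨ QP.*-monoˡ-≤-nonNeg (β - κ) {{β-κ≥0}} (toℚ-mono-≤ m≤n) ⟩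
  (β - κ) * toℚ n       ≡⟨ *-distrib-- β κ (toℚ n) ⟩
  β * toℚ n - κ * toℚ n ≤⟨ QP.+-mono-≤ βn≤c (QP.neg-antimono-≤ u≤κn) ⟩
  toℚ c - toℚ u         ≤⟨ QP.+-monoˡ-≤ (- toℚ u) (subst (toℚ c ≤_) (toℚ-+ c′ u) (toℚ-mono-≤ c≤c′+u)) ⟩
  (toℚ c′ + toℚ u) - toℚ u ≡⟨ +-∸ (toℚ c′) (toℚ u) ⟩
  toℚ c′                ∎
  where
  open QP.≤-Reasoning
  open +-*-Solver
  *-distrib-- : ∀ p q r → (p - q) * r ≡ p * r - q * r
  *-distrib-- = solve 3 (λ p q r → (p :- q) :* r := p :* r :- q :* r) refl
  +-∸ : ∀ p q → (p + q) - q ≡ p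
  +-∸ = solve 2 (λ p q → (p :+ q) :- q := p) refl
  β-κ≥0 : NonNegative (β - κ)
  β-κ≥0 = nonNegative (subst (_≤ β - κ) (QP.+-inverseʳ κ) (QP.+-monoˡ-≤ (- κ) κ≤β))

highCodeg-induced-∁ : ∀ {n β κ} (U : Subset n) (E : Edges n) →
                      κ ≤ β → toℚ ∣ U ∣ ≤ κ * toℚ n → ∀ {a b} → a ∉ U → b ∉ U →
                      HighCodeg β n E a b → HighCodeg (β - κ) ∣ ∁ U ∣ (induced (∁ U) E) a b
highCodeg-induced-∁ U E κ≤β ∣U∣≤κn a∉U b∉U high =
  threshold-drop {u = ∣ U ∣} κ≤β (∣∁∣≤n U) high ∣U∣≤κn (codeg≤codeg-induced-∁+∣∣ U E a∉U b∉U)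

relevant-induced-∁ : ∀ {n} β κ (E : Edges n) → κ < β →
                     MinPosCodegAtLeast (thin β n E) (β * toℚ n) →
                     ∀ {x y} → Relevant β n E x y →
                     ∀ (U : Subset n) → toℚ ∣ U ∣ ≤ κ * toℚ n → x ∉ U → y ∉ U →
                     Relevant (β - κ) ∣ ∁ U ∣ (induced (∁ U) E) x y
relevant-induced-∁ {n} β κ E κ<β δ {x} {y} xy U ∣U∣≤κn x∉U y∉U =
  let w , w∉U , xyw = ∃-outside U (thin β n E x y) ∣U∣<deg
      e , xy-high , xw-high , yw-high = thin-sound β n E x y w xyw
      keep = highCodeg-induced-∁ U E (QP.<⇒≤ κ<β) ∣U∣≤κn
  in w , thin-complete (β - κ) ∣ ∁ U ∣ (induced (∁ U) E) x y w
           (induced-∁-edge U E x∉U y∉U w∉U e)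
           (keep x∉U y∉U xy-high) (keep x∉U w∉U xw-high) (keep y∉U w∉U yw-high)
  where
  open QP.≤-Reasoning
  ∣U∣<deg : ∣ U ∣ ℕ.< codeg (thin β n E) x y
  ∣U∣<deg = toℚ-cancel-< (begin-strict
    toℚ ∣ U ∣                          ≤⟨ ∣U∣≤κn ⟩
    κ * toℚ n                          <⟨ QP.*-monoˡ-<-pos (toℚ n) {{toℚ-pos n {{nonZeroIndex x}}}} κ<β ⟩
    β * toℚ n                          ≤⟨ δ x y xy ⟩
    toℚ (codeg (thin β n E) x y)       ∎)

mainTheorem6 : (κ β : ℚ) → 0ℚ < κ → κ < β → β ≤ 1ℚ →
    ∃ λ (n₀ : ℕ) → ∀ (n : ℕ) → n ≥ n₀ →
    (E : Edges n) → Is3Graph E →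
    MinPosCodegAtLeast (thin β n E) (β * toℚ n) →
    ∀ x y → Relevant β n E x y →
    ∀ (U : Subset n) → toℚ ∣ U ∣ ≤ κ * toℚ n → x ∉ U → y ∉ U →
    Relevant (β - κ) ∣ ∁ U ∣ (induced (∁ U) E) x y
mainTheorem6 κ β _ κ<β _ = 0 , λ n _ E _ δ x y xy → relevant-induced-∁ β κ E κ<β δ xy
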